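{- Let $\mathbf a=(a_n)_{n\ge0}$, $\mathbf b=(b_n)_{n\ge1}$, $\mathbf c=(c_n)_{n\ge1}$, $\mathbf d=(d_n)_{n\ge0}$, $\mathbf e=(e_n)_{n\ge0}$, $\mathbf f=(f_n)_{n\ge1}$, $\mathbf g=(g_n)_{n\ge0}$, $\mathbf h=(h_n)_{n\ge0}$ be indeterminates. Let $L_1$ be the lower-bidiagonal matrix with $a_0,a_1,\dots$ on the diagonal and $b_1,b_2,\dots$ on the subdiagonal; $U$ the upper-bidiagonal matrix with $d_0,d_1,\dots$ on the diagonal and $c_1,c_2,\dots$ on the superdiagonal; $L_2$ the lower-bidiagonal matrix with $e_0,e_1,\dots$ on the diagonal and $f_1,f_2,\dots$ on the subdiagonal; $D_1=\mathrm{diag}(g_0,g_1,\dots)$ and $D_2=\mathrm{diag}(h_0,h_1,\dots)$ (all matrices indexed by $\mathbb N\times\mathbb N$). Then the matrix $$P=L_1UL_2+L_1D_1+D_2L_2$$ is totally positive, coefficientwise in the indeterminates $\mathbf a,\mathbf b,\mathbf c,\mathbf d,\mathbf e,\mathbf f,\mathbf g,\mathbf h$.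
   Context: Coefficientwise total positivity: every minor is a polynomial with nonnegative coefficients in the indicated indeterminates. -}

module Defs where

open import Data.Nat as ℕ using (ℕ; zero; suc; _∸_; _≟_)
import Data.Nat
open import Data.Integer as ℤ using (ℤ; +_)
open import Data.Fin using (Fin; zero; suc; punchIn; toℕ)
import Data.Fin
open import Data.List using (List; []; _∷_; map; concatMap; upTo; foldr)
open import Data.Product using (_×_; _,_)
open import Data.Bool using (Bool; true; false; _∧_; if_then_else_)
open import Relation.Nullary using (yes; no)

-- Multivariate polynomials over ℤ in the indeterminates x₀, x₁, x₂, …
-- given as expressions, together with their (semantic) coefficient map.

infixl 6 _⊕_
infixl 7 _⊗_

data Poly : Set where
  var   : ℕ → Poly
  const : ℤ → Poly
  _⊕_   : Poly → Poly → Poly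
  _⊗_   : Poly → Poly → Poly

-- A monomial x₀^{m₀} x₁^{m₁} … x_{k-1}^{m_{k-1}} is represented by its exponent
-- list [m₀, …, m_{k-1}] (all further exponents are 0).
Monomial : Set
Monomial = List ℕ

allZero : Monomial → Bool
allZero []           = true
allZero (zero ∷ m)   = allZero m
allZero (suc _ ∷ _)  = false

isUnit : ℕ → Monomial → Bool
isUnit _       []                 = false
isUnit zero    (suc zero ∷ m)     = allZero m
isUnit zero    (_ ∷ _)            = false
isUnit (suc i) (zero ∷ m)         = isUnit i m
isUnit (suc i) (suc _ ∷ _)        = false

splits : Monomial → List (Monomial × Monomial)
splits []      = ([] , []) ∷ []
splits (k ∷ m) =
  concatMap (λ j → map (λ { (x , y) → (j ∷ x , (k ∸ j) ∷ y) }) (splits m))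
            (upTo (suc k))

sumℤ : List ℤ → ℤ
sumℤ = foldr ℤ._+_ (+ 0)

coeff : Poly → Monomial → ℤ
coeff (var i)   m = if isUnit i m then + 1 else + 0
coeff (const c) m = if allZero m then c else + 0
coeff (p ⊕ q)   m = coeff p m ℤ.+ coeff q m
coeff (p ⊗ q)   m =
  sumℤ (map (λ { (x , y) → coeff p x ℤ.* coeff q y }) (splits m))

NonnegCoeffs : Poly → Set
NonnegCoeffs p = ∀ (m : Monomial) → + 0 ℤ.≤ coeff p m

0P 1P : Poly
0P = const (+ 0)
1P = const (+ 1)

ΣFin : (k : ℕ) → (Fin k → Poly) → Poly
ΣFin zero    f = 0P
ΣFin (suc k) f = f zero ⊕ ΣFin k (λ i → f (suc i))

Σ< : ℕ → (ℕ → Poly) → Poly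
Σ< zero    f = 0P
Σ< (suc n) f = Σ< n f ⊕ f n

signed : ℕ → Poly → Poly
signed zero          p = p
signed (suc zero)    p = const (ℤ.- (+ 1)) ⊗ p
signed (suc (suc n)) p = signed n p

det : (k : ℕ) → (Fin k → Fin k → Poly) → Poly
det zero    M = 1P
det (suc k) M =
  ΣFin (suc k) (λ j → signed (toℕ j)
    (M zero j ⊗ det k (λ r s → M (suc r) (punchIn j s))))

Matrix : Set
Matrix = ℕ → ℕ → Poly

_+ᴹ_ : Matrix → Matrix → Matrix
(X +ᴹ Y) i j = X i j ⊕ Y i j

-- Matrix product (X Y)_{ij} = Σ_l X_{il} Y_{lj}.  All left factors used below
-- have row i supported in columns l ≤ i + 1, so the sum over l < i + 2 is the
-- full (exact) matrix product for them.
_*ᴹ_ : Matrix → Matrix → Matrix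
(X *ᴹ Y) i j = Σ< (suc (suc i)) (λ l → X i l ⊗ Y l j)

StrictlyIncreasing : {k : ℕ} → (Fin k → ℕ) → Set
StrictlyIncreasing {k} r = ∀ (p q : Fin k) → p Data.Fin.< q → r p Data.Nat.< r q

CoeffTP : Matrix → Set
CoeffTP A = ∀ (k : ℕ) (r c : Fin k → ℕ) →
  StrictlyIncreasing r → StrictlyIncreasing c →
  NonnegCoeffs (det k (λ p q → A (r p) (c q)))

-- The indeterminates a,b,c,d,e,f,g,h : the n-th member of the t-th family
-- (t = 0..7 for a..h) is the variable x_{8n+t}.

indet : ℕ → ℕ → Poly
indet t n = var (8 ℕ.* n ℕ.+ t)

aV bV cV dV eV fV gV hV : ℕ → Poly
aV = indet 0
bV = indet 1   -- only b₁, b₂, … are used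
cV = indet 2   -- only c₁, c₂, … are used
dV = indet 3
eV = indet 4
fV = indet 5   -- only f₁, f₂, … are used
gV = indet 6
hV = indet 7

-- lower-bidiagonal: diag x₀, x₁, … ; subdiagonal entry (n, n-1) is y_n (n ≥ 1)
lowerBidiag : (ℕ → Poly) → (ℕ → Poly) → Matrix
lowerBidiag x y i j with i ≟ j
... | yes _ = x i
... | no _ with i ≟ suc j
...   | yes _ = y i
...   | no _  = 0P

-- upper-bidiagonal: diag x₀, x₁, … ; superdiagonal entry (n-1, n) is y_n (n ≥ 1)
upperBidiag : (ℕ → Poly) → (ℕ → Poly) → Matrix
upperBidiag x y i j with i ≟ j
... | yes _ = x i
... | no _ with suc i ≟ j
...   | yes _ = y j
...   | no _  = 0P

diagM : (ℕ → Poly) → Matrix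
diagM x i j with i ≟ j
... | yes _ = x i
... | no _  = 0P

L₁ U L₂ D₁ D₂ : Matrix
L₁ = lowerBidiag aV bV
U  = upperBidiag dV cV
L₂ = lowerBidiag eV fV
D₁ = diagM gV
D₂ = diagM hV

P : Matrix
P = (((L₁ *ᴹ U) *ᴹ L₂) +ᴹ (L₁ *ᴹ D₁)) +ᴹ (D₂ *ᴹ L₂)

{-# OPTIONS --safe #-}
-- P is obtained from the identity matrix by three right multiplications A ↦ A ◂ W, each replacing
-- column n by a combination, with coefficientwise nonnegative weights, of columns of A whose indices
-- increase weakly with n. Such a multiplication preserves coefficientwise total positivity: by
-- multilinearity of the determinant in its columns, a minor of A ◂ W expands into minors of A with
-- weakly increasing column indices times products of weights, and those with a repeated index vanish.
-- The three steps interleave the columns of D₂ and L₁, then form the columns of D₂ + L₁U and L₁D₁,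
-- and finally combine them into (D₂ + L₁U) L₂ + L₁D₁ = P.

module Submission where

open import Algebra.Bundles using (CommutativeSemiring)
import Algebra.Properties.CommutativeSemigroup as CommSemigroupProperties
open import Algebra.Structures using (IsCommutativeSemiring)
open import Data.Bool using (true; false)
open import Data.Empty using (⊥-elim)
open import Data.Fin as Fin using (Fin; zero; suc; punchIn; toℕ; inject₁; fromℕ<)
import Data.Fin.Properties as Finₚ
open import Data.Integer as ℤ using (ℤ; +_; +≤+; _+_; _*_)
import Data.Integer.Properties as ℤₚ
open import Data.List using (List; []; _∷_; map; concatMap; upTo; applyUpTo; _++_)
open import Data.List.Membership.Propositional using (_∈_)
open import Data.List.Relation.Unary.All as All using (All; []; _∷_)
open import Data.List.Relation.Unary.Any using (here; there)
import Data.List.Properties as Listₚ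
open import Data.Nat as ℕ using (ℕ; zero; suc; _∸_; _≤_; _<_; z≤n; s≤s; _≟_)
import Data.Nat.Properties as ℕₚ
open import Data.Product using (_×_; _,_; proj₁; proj₂; Σ-syntax)
open import Data.Sum using (_⊎_; inj₁; inj₂)
open import Data.Vec.Functional using (updateAt)
open import Data.Vec.Functional.Properties using (updateAt-updates; updateAt-minimal)
open import Function using (_∘_; id)
open import Relation.Binary.PropositionalEquality
open import Relation.Nullary using (Dec; yes; no)

open import Defs

open ≡-Reasoning

sumℤ-++ : ∀ (xs ys : List ℤ) → sumℤ (xs ++ ys) ≡ sumℤ xs + sumℤ ys
sumℤ-++ []       ys = sym (ℤₚ.+-identityˡ _)
sumℤ-++ (x ∷ xs) ys = trans (cong (_+_ x) (sumℤ-++ xs ys)) (sym (ℤₚ.+-assoc x _ _))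

open CommSemigroupProperties ℤₚ.+-commutativeSemigroup using (interchange)

module _ {A : Set} where

  sum-map-cong : ∀ (xs : List A) {F G : A → ℤ} → (∀ z → F z ≡ G z) →
                 sumℤ (map F xs) ≡ sumℤ (map G xs)
  sum-map-cong []       F≡G = refl
  sum-map-cong (x ∷ xs) F≡G = cong₂ _+_ (F≡G x) (sum-map-cong xs F≡G)

  sum-map-+ : ∀ (xs : List A) (F G : A → ℤ) →
              sumℤ (map (λ z → F z + G z) xs) ≡ sumℤ (map F xs) + sumℤ (map G xs)
  sum-map-+ []       F G = refl
  sum-map-+ (x ∷ xs) F G =
    trans (cong (_+_ (F x + G x)) (sum-map-+ xs F G)) (interchange (F x) (G x) _ _)

  sum-map-*ˡ : ∀ (xs : List A) (c : ℤ) (F : A → ℤ) →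
               c * sumℤ (map F xs) ≡ sumℤ (map (λ z → c * F z) xs)
  sum-map-*ˡ []       c F = ℤₚ.*-zeroʳ c
  sum-map-*ˡ (x ∷ xs) c F =
    trans (ℤₚ.*-distribˡ-+ c (F x) _) (cong (_+_ (c * F x)) (sum-map-*ˡ xs c F))

  sum-map-*ʳ : ∀ (xs : List A) (c : ℤ) (F : A → ℤ) →
               sumℤ (map F xs) * c ≡ sumℤ (map (λ z → F z * c) xs)
  sum-map-*ʳ xs c F = begin
    sumℤ (map F xs) * c             ≡⟨ ℤₚ.*-comm _ c ⟩
    c * sumℤ (map F xs)             ≡⟨ sum-map-*ˡ xs c F ⟩
    sumℤ (map (λ z → c * F z) xs)   ≡⟨ sum-map-cong xs (λ z → ℤₚ.*-comm c (F z)) ⟩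
    sumℤ (map (λ z → F z * c) xs)   ∎

  sum-map-zero : ∀ (xs : List A) {F : A → ℤ} → (∀ z → F z ≡ + 0) → sumℤ (map F xs) ≡ + 0
  sum-map-zero []       F≡0 = refl
  sum-map-zero (x ∷ xs) F≡0 = cong₂ _+_ (F≡0 x) (sum-map-zero xs F≡0)

sum-map-concatMap : ∀ {A B : Set} (xs : List A) (g : A → List B) (F : B → ℤ) →
  sumℤ (map F (concatMap g xs)) ≡ sumℤ (map (λ x → sumℤ (map F (g x))) xs)
sum-map-concatMap []       g F = refl
sum-map-concatMap (x ∷ xs) g F = begin
  sumℤ (map F (g x ++ concatMap g xs))
    ≡⟨ cong sumℤ (Listₚ.map-++ F (g x) (concatMap g xs)) ⟩
  sumℤ (map F (g x) ++ map F (concatMap g xs))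
    ≡⟨ sumℤ-++ (map F (g x)) _ ⟩
  sumℤ (map F (g x)) + sumℤ (map F (concatMap g xs))
    ≡⟨ cong (_+_ (sumℤ (map F (g x)))) (sum-map-concatMap xs g F) ⟩
  sumℤ (map (λ x → sumℤ (map F (g x))) (x ∷ xs)) ∎

sumUpTo : ℕ → (ℕ → ℤ) → ℤ
sumUpTo zero    f = f 0 + + 0
sumUpTo (suc k) f = f 0 + sumUpTo k (f ∘ suc)

sum-map-applyUpTo : ∀ k (f : ℕ → ℕ) (G : ℕ → ℤ) →
  sumℤ (map G (applyUpTo f (suc k))) ≡ sumUpTo k (G ∘ f)
sum-map-applyUpTo zero    f G = refl
sum-map-applyUpTo (suc k) f G = cong (_+_ (G (f 0))) (sum-map-applyUpTo k (f ∘ suc) G)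

sumUpTo-cong : ∀ k {f g : ℕ → ℤ} → (∀ j → j ≤ k → f j ≡ g j) → sumUpTo k f ≡ sumUpTo k g
sumUpTo-cong zero    f≡g = cong (_+ + 0) (f≡g 0 z≤n)
sumUpTo-cong (suc k) f≡g = cong₂ _+_ (f≡g 0 z≤n) (sumUpTo-cong k (λ j j≤k → f≡g (suc j) (s≤s j≤k)))

sumUpTo-+ : ∀ k (f g : ℕ → ℤ) → sumUpTo k (λ j → f j + g j) ≡ sumUpTo k f + sumUpTo k g
sumUpTo-+ zero    f g = interchange (f 0) (g 0) (+ 0) (+ 0)
sumUpTo-+ (suc k) f g =
  trans (cong (_+_ (f 0 + g 0)) (sumUpTo-+ k (f ∘ suc) (g ∘ suc))) (interchange (f 0) (g 0) _ _)

sumUpTo-zero : ∀ k {f : ℕ → ℤ} → (∀ j → f j ≡ + 0) → sumUpTo k f ≡ + 0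
sumUpTo-zero zero    f≡0 = cong (_+ + 0) (f≡0 0)
sumUpTo-zero (suc k) f≡0 = cong₂ _+_ (f≡0 0) (sumUpTo-zero k (f≡0 ∘ suc))

sumUpTo-head : ∀ k (f : ℕ → ℤ) → (∀ j → f (suc j) ≡ + 0) → sumUpTo k f ≡ f 0
sumUpTo-head zero    f _   = ℤₚ.+-identityʳ _
sumUpTo-head (suc k) f f≡0 = trans (cong (_+_ (f 0)) (sumUpTo-zero k f≡0)) (ℤₚ.+-identityʳ _)

sumUpTo-suc : ∀ k (f : ℕ → ℤ) → sumUpTo (suc k) f ≡ sumUpTo k f + f (suc k)
sumUpTo-suc zero    f =
  trans (cong (_+_ (f 0)) (ℤₚ.+-comm (f 1) (+ 0))) (sym (ℤₚ.+-assoc (f 0) (+ 0) (f 1)))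
sumUpTo-suc (suc k) f =
  trans (cong (_+_ (f 0)) (sumUpTo-suc k (f ∘ suc))) (sym (ℤₚ.+-assoc (f 0) _ _))

sumUpTo-reverse : ∀ k (f : ℕ → ℤ) → sumUpTo k f ≡ sumUpTo k (λ j → f (k ∸ j))
sumUpTo-reverse zero    f = refl
sumUpTo-reverse (suc k) f = begin
  f 0 + sumUpTo k (f ∘ suc)
    ≡⟨ cong (_+_ (f 0)) (sumUpTo-reverse k (f ∘ suc)) ⟩
  f 0 + sumUpTo k (λ j → f (suc (k ∸ j)))
    ≡⟨ cong (_+_ (f 0)) (sumUpTo-cong k (λ j j≤k → cong f (sym (ℕₚ.+-∸-assoc 1 j≤k)))) ⟩
  f 0 + sumUpTo k (λ j → f (suc k ∸ j))
    ≡⟨ ℤₚ.+-comm (f 0) _ ⟩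
  sumUpTo k (λ j → f (suc k ∸ j)) + f 0
    ≡⟨ cong (λ t → sumUpTo k (λ j → f (suc k ∸ j)) + f t) (sym (ℕₚ.n∸n≡0 k)) ⟩
  sumUpTo k (λ j → f (suc k ∸ j)) + f (suc k ∸ suc k)
    ≡⟨ sym (sumUpTo-suc k (λ j → f (suc k ∸ j))) ⟩
  sumUpTo (suc k) (λ j → f (suc k ∸ j)) ∎

sumUpTo-triangle : ∀ k (Ψ : ℕ → ℕ → ℤ) →
  sumUpTo k (λ j → sumUpTo j (λ i → Ψ i (j ∸ i))) ≡ sumUpTo k (λ i → sumUpTo (k ∸ i) (Ψ i))
sumUpTo-triangle zero    Ψ = refl
sumUpTo-triangle (suc k) Ψ = begin
  sumUpTo (suc k) (λ j → sumUpTo j (λ i → Ψ i (j ∸ i)))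
    ≡⟨ sumUpTo-suc k _ ⟩
  sumUpTo k (λ j → sumUpTo j (λ i → Ψ i (j ∸ i))) + sumUpTo (suc k) (λ i → Ψ i (suc k ∸ i))
    ≡⟨ cong₂ _+_ (sumUpTo-triangle k Ψ) (sumUpTo-suc k _) ⟩
  sumUpTo k (λ i → sumUpTo (k ∸ i) (Ψ i)) + (sumUpTo k (λ i → Ψ i (suc k ∸ i)) + Ψ (suc k) (k ∸ k))
    ≡⟨ sym (ℤₚ.+-assoc (sumUpTo k (λ i → sumUpTo (k ∸ i) (Ψ i))) _ _) ⟩
  (sumUpTo k (λ i → sumUpTo (k ∸ i) (Ψ i)) + sumUpTo k (λ i → Ψ i (suc k ∸ i))) + Ψ (suc k) (k ∸ k)
    ≡⟨ cong (_+ Ψ (suc k) (k ∸ k)) (sym (sumUpTo-+ k _ _)) ⟩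
  sumUpTo k (λ i → sumUpTo (k ∸ i) (Ψ i) + Ψ i (suc k ∸ i)) + Ψ (suc k) (k ∸ k)
    ≡⟨ cong (_+ Ψ (suc k) (k ∸ k)) (sumUpTo-cong k extend) ⟩
  sumUpTo k (λ i → sumUpTo (suc k ∸ i) (Ψ i)) + Ψ (suc k) (k ∸ k)
    ≡⟨ cong (_+_ (sumUpTo k (λ i → sumUpTo (suc k ∸ i) (Ψ i)))) corner ⟩
  sumUpTo k (λ i → sumUpTo (suc k ∸ i) (Ψ i)) + sumUpTo (suc k ∸ suc k) (Ψ (suc k))
    ≡⟨ sym (sumUpTo-suc k _) ⟩
  sumUpTo (suc k) (λ i → sumUpTo (suc k ∸ i) (Ψ i)) ∎
  where
  extend : ∀ i → i ≤ k → sumUpTo (k ∸ i) (Ψ i) + Ψ i (suc k ∸ i) ≡ sumUpTo (suc k ∸ i) (Ψ i)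
  extend i i≤k rewrite ℕₚ.+-∸-assoc 1 i≤k = sym (sumUpTo-suc (k ∸ i) (Ψ i))
  corner : Ψ (suc k) (k ∸ k) ≡ sumUpTo (k ∸ k) (Ψ (suc k))
  corner rewrite ℕₚ.n∸n≡0 k = sym (ℤₚ.+-identityʳ _)

Σsplits : Monomial → (Monomial × Monomial → ℤ) → ℤ
Σsplits m F = sumℤ (map F (splits m))

Σsplits-cong : ∀ m {F G : Monomial × Monomial → ℤ} → (∀ z → F z ≡ G z) → Σsplits m F ≡ Σsplits m G
Σsplits-cong m = sum-map-cong (splits m)

Σsplits-∷ : ∀ k m (F : Monomial × Monomial → ℤ) →
  Σsplits (k ∷ m) F ≡ sumUpTo k (λ j → Σsplits m (λ (x , y) → F (j ∷ x , (k ∸ j) ∷ y)))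
Σsplits-∷ k m F = begin
  Σsplits (k ∷ m) F
    ≡⟨ sum-map-concatMap (upTo (suc k)) (λ j → map (λ (x , y) → j ∷ x , (k ∸ j) ∷ y) (splits m)) F ⟩
  sumℤ (map (λ j → sumℤ (map F (map (λ (x , y) → j ∷ x , (k ∸ j) ∷ y) (splits m)))) (upTo (suc k)))
    ≡⟨ sum-map-applyUpTo k id _ ⟩
  sumUpTo k (λ j → sumℤ (map F (map (λ (x , y) → j ∷ x , (k ∸ j) ∷ y) (splits m))))
    ≡⟨ sumUpTo-cong k (λ j _ → cong sumℤ (sym (Listₚ.map-∘ (splits m)))) ⟩
  sumUpTo k (λ j → Σsplits m (λ (x , y) → F (j ∷ x , (k ∸ j) ∷ y))) ∎

Σsplits-sumUpTo : ∀ m j (F : ℕ → Monomial × Monomial → ℤ) →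
  Σsplits m (λ z → sumUpTo j (λ i → F i z)) ≡ sumUpTo j (λ i → Σsplits m (F i))
Σsplits-sumUpTo m zero    F =
  trans (sum-map-+ (splits m) (F 0) (λ _ → + 0))
        (cong (_+_ (Σsplits m (F 0))) (sum-map-zero (splits m) (λ _ → refl)))
Σsplits-sumUpTo m (suc j) F =
  trans (sum-map-+ (splits m) (F 0) _) (cong (_+_ (Σsplits m (F 0))) (Σsplits-sumUpTo m j (F ∘ suc)))

Σsplits-swap : ∀ m (F : Monomial × Monomial → ℤ) → Σsplits m F ≡ Σsplits m (λ (x , y) → F (y , x))
Σsplits-swap []      F = refl
Σsplits-swap (k ∷ m) F = begin
  Σsplits (k ∷ m) F
    ≡⟨ Σsplits-∷ k m F ⟩
  sumUpTo k (λ j → Σsplits m (λ (x , y) → F (j ∷ x , (k ∸ j) ∷ y)))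
    ≡⟨ sumUpTo-cong k (λ j _ → Σsplits-swap m (λ (x , y) → F (j ∷ x , (k ∸ j) ∷ y))) ⟩
  sumUpTo k (λ j → G j (k ∸ j))
    ≡⟨ sumUpTo-reverse k (λ j → G j (k ∸ j)) ⟩
  sumUpTo k (λ j → G (k ∸ j) (k ∸ (k ∸ j)))
    ≡⟨ sumUpTo-cong k (λ j j≤k → cong (G (k ∸ j)) (ℕₚ.m∸[m∸n]≡n j≤k)) ⟩
  sumUpTo k (λ j → G (k ∸ j) j)
    ≡⟨ sym (Σsplits-∷ k m _) ⟩
  Σsplits (k ∷ m) (λ (x , y) → F (y , x)) ∎
  where
  G : ℕ → ℕ → ℤ
  G a b = Σsplits m (λ (x , y) → F (a ∷ y , b ∷ x))

Σsplits-assoc : ∀ m (G : Monomial → Monomial → Monomial → ℤ) →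
  Σsplits m (λ (x , z) → Σsplits x (λ (u , v) → G u v z)) ≡
  Σsplits m (λ (u , y) → Σsplits y (λ (v , z) → G u v z))
Σsplits-assoc []      G = refl
Σsplits-assoc (k ∷ m) G = begin
  Σsplits (k ∷ m) (λ (x , z) → Σsplits x (λ (u , v) → G u v z))
    ≡⟨ Σsplits-∷ k m _ ⟩
  sumUpTo k (λ j → Σsplits m (λ (x , z) → Σsplits (j ∷ x) (λ (u , v) → G u v ((k ∸ j) ∷ z))))
    ≡⟨ sumUpTo-cong k (λ j _ → Σsplits-cong m (λ (x , z) → Σsplits-∷ j x _)) ⟩
  sumUpTo k (λ j → Σsplits m (λ (x , z) → sumUpTo j (λ i →
    Σsplits x (λ (u , v) → G (i ∷ u) ((j ∸ i) ∷ v) ((k ∸ j) ∷ z)))))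
    ≡⟨ sumUpTo-cong k (λ j _ → Σsplits-sumUpTo m j _) ⟩
  sumUpTo k (λ j → sumUpTo j (λ i → Σsplits m (λ (x , z) →
    Σsplits x (λ (u , v) → G (i ∷ u) ((j ∸ i) ∷ v) ((k ∸ j) ∷ z)))))
    ≡⟨ sumUpTo-cong k (λ j _ → sumUpTo-cong j (λ i i≤j → inner j i i≤j)) ⟩
  sumUpTo k (λ j → sumUpTo j (λ i → Ψ i (j ∸ i)))
    ≡⟨ sumUpTo-triangle k Ψ ⟩
  sumUpTo k (λ i → sumUpTo (k ∸ i) (Ψ i))
    ≡⟨ sumUpTo-cong k (λ i _ → sumUpTo-cong (k ∸ i) λ t _ → cong (Φ i t) (sym (ℕₚ.∸-+-assoc k i t))) ⟩
  sumUpTo k (λ i → sumUpTo (k ∸ i) (λ t → Φ i t (k ∸ i ∸ t)))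
    ≡⟨ sumUpTo-cong k (λ i _ → sym (Σsplits-sumUpTo m (k ∸ i) _)) ⟩
  sumUpTo k (λ i → Σsplits m (λ (u , y) → sumUpTo (k ∸ i) (λ t →
    Σsplits y (λ (v , z) → G (i ∷ u) (t ∷ v) ((k ∸ i ∸ t) ∷ z)))))
    ≡⟨ sumUpTo-cong k (λ i _ → Σsplits-cong m (λ (u , y) → sym (Σsplits-∷ (k ∸ i) y _))) ⟩
  sumUpTo k (λ i → Σsplits m (λ (u , y) → Σsplits ((k ∸ i) ∷ y) (λ (v , z) → G (i ∷ u) v z)))
    ≡⟨ sym (Σsplits-∷ k m _) ⟩
  Σsplits (k ∷ m) (λ (u , y) → Σsplits y (λ (v , z) → G u v z)) ∎
  where
  Φ : ℕ → ℕ → ℕ → ℤ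
  Φ i t s = Σsplits m (λ (u , y) → Σsplits y (λ (v , z) → G (i ∷ u) (t ∷ v) (s ∷ z)))
  Ψ : ℕ → ℕ → ℤ
  Ψ i t = Φ i t (k ∸ (i ℕ.+ t))
  inner : ∀ j i → i ≤ j →
    Σsplits m (λ (x , z) → Σsplits x (λ (u , v) → G (i ∷ u) ((j ∸ i) ∷ v) ((k ∸ j) ∷ z))) ≡
    Ψ i (j ∸ i)
  inner j i i≤j rewrite ℕₚ.m+[n∸m]≡n i≤j =
    Σsplits-assoc m (λ u v z → G (i ∷ u) ((j ∸ i) ∷ v) ((k ∸ j) ∷ z))

Σsplits-constˡ : ∀ m (c : ℤ) (F : Monomial → ℤ) →
  Σsplits m (λ (x , y) → coeff (const c) x * F y) ≡ c * F m
Σsplits-constˡ []      c F = ℤₚ.+-identityʳ _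
Σsplits-constˡ (k ∷ m) c F = begin
  Σsplits (k ∷ m) (λ (x , y) → coeff (const c) x * F y)
    ≡⟨ Σsplits-∷ k m _ ⟩
  sumUpTo k (λ j → Σsplits m (λ (x , y) → coeff (const c) (j ∷ x) * F ((k ∸ j) ∷ y)))
    ≡⟨ sumUpTo-head k _ (λ j → sum-map-zero (splits m) λ (_ , y) → ℤₚ.*-zeroˡ (F ((k ∸ suc j) ∷ y))) ⟩
  Σsplits m (λ (x , y) → coeff (const c) x * F (k ∷ y))
    ≡⟨ Σsplits-constˡ m c (F ∘ (k ∷_)) ⟩
  c * F (k ∷ m) ∎

-- Coefficientwise equality: polynomials form a commutative semiring

infix 4 _≈_
record _≈_ (p q : Poly) : Set where
  constructor coeffwise
  field coeff-≡ : ∀ m → coeff p m ≡ coeff q m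
open _≈_

≈-refl : ∀ {p} → p ≈ p
≈-refl = coeffwise (λ _ → refl)

≈-sym : ∀ {p q} → p ≈ q → q ≈ p
≈-sym p≈q = coeffwise (λ m → sym (coeff-≡ p≈q m))

≈-trans : ∀ {p q r} → p ≈ q → q ≈ r → p ≈ r
≈-trans p≈q q≈r = coeffwise (λ m → trans (coeff-≡ p≈q m) (coeff-≡ q≈r m))

≡⇒≈ : ∀ {p q} → p ≡ q → p ≈ q
≡⇒≈ refl = ≈-refl

coeff-0P : ∀ m → coeff 0P m ≡ + 0
coeff-0P m with allZero m
... | true  = refl
... | false = refl

coeff-const⊗ : ∀ c p m → coeff (const c ⊗ p) m ≡ c * coeff p m
coeff-const⊗ c p m = Σsplits-constˡ m c (coeff p)

⊕-cong : ∀ {p p′ q q′} → p ≈ p′ → q ≈ q′ → p ⊕ q ≈ p′ ⊕ q′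
⊕-cong p≈p′ q≈q′ = coeffwise (λ m → cong₂ _+_ (coeff-≡ p≈p′ m) (coeff-≡ q≈q′ m))

⊗-cong : ∀ {p p′ q q′} → p ≈ p′ → q ≈ q′ → p ⊗ q ≈ p′ ⊗ q′
⊗-cong p≈p′ q≈q′ = coeffwise λ m →
  Σsplits-cong m (λ (x , y) → cong₂ _*_ (coeff-≡ p≈p′ x) (coeff-≡ q≈q′ y))

⊗-congˡ : ∀ {p q q′} → q ≈ q′ → p ⊗ q ≈ p ⊗ q′
⊗-congˡ = ⊗-cong ≈-refl

⊗-congʳ : ∀ {p p′ q} → p ≈ p′ → p ⊗ q ≈ p′ ⊗ q
⊗-congʳ p≈p′ = ⊗-cong p≈p′ ≈-refl

⊕-assoc : ∀ p q r → (p ⊕ q) ⊕ r ≈ p ⊕ (q ⊕ r)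
⊕-assoc p q r = coeffwise (λ m → ℤₚ.+-assoc (coeff p m) (coeff q m) (coeff r m))

⊕-comm : ∀ p q → p ⊕ q ≈ q ⊕ p
⊕-comm p q = coeffwise (λ m → ℤₚ.+-comm (coeff p m) (coeff q m))

⊕-identityˡ : ∀ p → 0P ⊕ p ≈ p
⊕-identityˡ p = coeffwise (λ m → trans (cong (_+ coeff p m) (coeff-0P m)) (ℤₚ.+-identityˡ _))

⊕-identityʳ : ∀ p → p ⊕ 0P ≈ p
⊕-identityʳ p = ≈-trans (⊕-comm p 0P) (⊕-identityˡ p)

⊗-comm : ∀ p q → p ⊗ q ≈ q ⊗ p
⊗-comm p q = coeffwise λ m →
  trans (Σsplits-swap m _) (Σsplits-cong m (λ (x , y) → ℤₚ.*-comm (coeff p y) (coeff q x)))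

⊗-assoc : ∀ p q r → (p ⊗ q) ⊗ r ≈ p ⊗ (q ⊗ r)
⊗-assoc p q r = coeffwise λ m → begin
  Σsplits m (λ (x , z) → Σsplits x (λ (u , v) → cp u * cq v) * cr z)
    ≡⟨ Σsplits-cong m (λ (x , z) → sum-map-*ʳ (splits x) (cr z) _) ⟩
  Σsplits m (λ (x , z) → Σsplits x (λ (u , v) → cp u * cq v * cr z))
    ≡⟨ Σsplits-assoc m (λ u v z → cp u * cq v * cr z) ⟩
  Σsplits m (λ (u , y) → Σsplits y (λ (v , z) → cp u * cq v * cr z))
    ≡⟨ Σsplits-cong m (λ (u , y) → Σsplits-cong y (λ (v , z) → ℤₚ.*-assoc (cp u) (cq v) (cr z))) ⟩
  Σsplits m (λ (u , y) → Σsplits y (λ (v , z) → cp u * (cq v * cr z)))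
    ≡⟨ Σsplits-cong m (λ (u , y) → sym (sum-map-*ˡ (splits y) (cp u) _)) ⟩
  Σsplits m (λ (u , y) → cp u * Σsplits y (λ (v , z) → cq v * cr z)) ∎
  where
  cp cq cr : Monomial → ℤ
  cp = coeff p
  cq = coeff q
  cr = coeff r

⊗-identityˡ : ∀ p → 1P ⊗ p ≈ p
⊗-identityˡ p = coeffwise (λ m → trans (coeff-const⊗ (+ 1) p m) (ℤₚ.*-identityˡ _))

⊗-identityʳ : ∀ p → p ⊗ 1P ≈ p
⊗-identityʳ p = ≈-trans (⊗-comm p 1P) (⊗-identityˡ p)

⊗-zeroˡ : ∀ p → 0P ⊗ p ≈ 0P
⊗-zeroˡ p = coeffwise λ m →
  trans (coeff-const⊗ (+ 0) p m) (trans (ℤₚ.*-zeroˡ (coeff p m)) (sym (coeff-0P m)))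

⊗-zeroʳ : ∀ p → p ⊗ 0P ≈ 0P
⊗-zeroʳ p = ≈-trans (⊗-comm p 0P) (⊗-zeroˡ p)

⊗-distribʳ : ∀ p q r → (q ⊕ r) ⊗ p ≈ (q ⊗ p) ⊕ (r ⊗ p)
⊗-distribʳ p q r = coeffwise λ m →
  trans (Σsplits-cong m (λ (x , y) → ℤₚ.*-distribʳ-+ (coeff p y) (coeff q x) (coeff r x)))
        (sum-map-+ (splits m) _ _)

⊗-distribˡ : ∀ p q r → p ⊗ (q ⊕ r) ≈ (p ⊗ q) ⊕ (p ⊗ r)
⊗-distribˡ p q r =
  ≈-trans (⊗-comm p (q ⊕ r)) (≈-trans (⊗-distribʳ p q r) (⊕-cong (⊗-comm q p) (⊗-comm r p)))

Poly-isCommutativeSemiring : IsCommutativeSemiring _≈_ _⊕_ _⊗_ 0P 1P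
Poly-isCommutativeSemiring = record
  { isSemiring = record
    { isSemiringWithoutAnnihilatingZero = record
      { +-isCommutativeMonoid = record
        { isMonoid = record
          { isSemigroup = record
            { isMagma = record
              { isEquivalence = record { refl = ≈-refl ; sym = ≈-sym ; trans = ≈-trans }
              ; ∙-cong = ⊕-cong }
            ; assoc = ⊕-assoc }
          ; identity = ⊕-identityˡ , ⊕-identityʳ }
        ; comm = ⊕-comm }
      ; *-cong = ⊗-cong
      ; *-assoc = ⊗-assoc
      ; *-identity = ⊗-identityˡ , ⊗-identityʳ
      ; distrib = ⊗-distribˡ , ⊗-distribʳ }
    ; zero = ⊗-zeroˡ , ⊗-zeroʳ }
  ; *-comm = ⊗-comm }

Poly-commutativeSemiring : CommutativeSemiring _ _
Poly-commutativeSemiring = record { isCommutativeSemiring = Poly-isCommutativeSemiring }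

open import Algebra.Solver.Ring.NaturalCoefficients.Default Poly-commutativeSemiring
  using (solve; _:+_; _:*_; _:=_; con)

nonneg-* : ∀ {a b} → + 0 ℤ.≤ a → + 0 ℤ.≤ b → + 0 ℤ.≤ a * b
nonneg-* {+ m} {+ n} _ _ = subst (+ 0 ℤ.≤_) (ℤₚ.pos-* m n) (+≤+ z≤n)

nonneg-sum : ∀ {A : Set} (xs : List A) {F : A → ℤ} → (∀ z → + 0 ℤ.≤ F z) →
  + 0 ℤ.≤ sumℤ (map F xs)
nonneg-sum []       _     = ℤₚ.≤-refl
nonneg-sum (x ∷ xs) F≥0 = ℤₚ.+-mono-≤ (F≥0 x) (nonneg-sum xs F≥0)

NonnegCoeffs-resp-≈ : ∀ {p q} → p ≈ q → NonnegCoeffs p → NonnegCoeffs q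
NonnegCoeffs-resp-≈ p≈q p≥0 m = subst (+ 0 ℤ.≤_) (coeff-≡ p≈q m) (p≥0 m)

NonnegCoeffs-⊕ : ∀ p q → NonnegCoeffs p → NonnegCoeffs q → NonnegCoeffs (p ⊕ q)
NonnegCoeffs-⊕ _ _ p≥0 q≥0 m = ℤₚ.+-mono-≤ (p≥0 m) (q≥0 m)

NonnegCoeffs-⊗ : ∀ p q → NonnegCoeffs p → NonnegCoeffs q → NonnegCoeffs (p ⊗ q)
NonnegCoeffs-⊗ _ _ p≥0 q≥0 m = nonneg-sum (splits m) (λ (x , y) → nonneg-* (p≥0 x) (q≥0 y))

NonnegCoeffs-const : ∀ n → NonnegCoeffs (const (+ n))
NonnegCoeffs-const n m with allZero m
... | true  = +≤+ z≤n
... | false = +≤+ z≤n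

NonnegCoeffs-var : ∀ i → NonnegCoeffs (var i)
NonnegCoeffs-var i m with isUnit i m
... | true  = +≤+ z≤n
... | false = +≤+ z≤n

-- Determinants

signed-cong : ∀ n {p q} → p ≈ q → signed n p ≈ signed n q
signed-cong zero          p≈q = p≈q
signed-cong (suc zero)    p≈q = ⊗-congˡ p≈q
signed-cong (suc (suc n)) p≈q = signed-cong n p≈q

signed-zero : ∀ n {p} → p ≈ 0P → signed n p ≈ 0P
signed-zero zero          p≈0 = p≈0
signed-zero (suc zero)    p≈0 = ≈-trans (⊗-congˡ p≈0) (⊗-zeroʳ _)
signed-zero (suc (suc n)) p≈0 = signed-zero n p≈0

signed-linear : ∀ n p q α β → signed n (p ⊗ α ⊕ q ⊗ β) ≈ signed n p ⊗ α ⊕ signed n q ⊗ β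
signed-linear zero          p q α β = ≈-refl
signed-linear (suc zero)    p q α β =
  solve 5 (λ c p q α β → c :* (p :* α :+ q :* β) := (c :* p) :* α :+ (c :* q) :* β)
    ≈-refl (const (ℤ.- + 1)) p q α β
signed-linear (suc (suc n)) p q α β = signed-linear n p q α β

signed-suc-cancel : ∀ n p → signed (suc n) p ⊕ signed n p ≈ 0P
signed-suc-cancel zero          p = neg-cancel
  where
  neg-cancel : const (ℤ.- + 1) ⊗ p ⊕ p ≈ 0P
  neg-cancel = coeffwise λ m → begin
    coeff (const (ℤ.- + 1) ⊗ p) m + coeff p m ≡⟨ cong (_+ coeff p m) (coeff-const⊗ (ℤ.- + 1) p m) ⟩
    ℤ.- + 1 * coeff p m + coeff p m          ≡⟨ cong (_+ coeff p m) (ℤₚ.-1*i≡-i (coeff p m)) ⟩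
    ℤ.- coeff p m + coeff p m                ≡⟨ ℤₚ.+-inverseˡ (coeff p m) ⟩
    + 0                                      ≡⟨ sym (coeff-0P m) ⟩
    coeff 0P m                               ∎
signed-suc-cancel (suc zero)    p = ≈-trans (⊕-comm p _) (signed-suc-cancel zero p)
signed-suc-cancel (suc (suc n)) p = signed-suc-cancel n p

ΣFin-cong : ∀ k {f g : Fin k → Poly} → (∀ t → f t ≈ g t) → ΣFin k f ≈ ΣFin k g
ΣFin-cong zero    f≈g = ≈-refl
ΣFin-cong (suc k) f≈g = ⊕-cong (f≈g zero) (ΣFin-cong k (f≈g ∘ suc))

ΣFin-zero : ∀ k {f : Fin k → Poly} → (∀ t → f t ≈ 0P) → ΣFin k f ≈ 0P
ΣFin-zero zero    f≈0 = ≈-refl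
ΣFin-zero (suc k) f≈0 = ≈-trans (⊕-cong (f≈0 zero) (ΣFin-zero k (f≈0 ∘ suc))) (⊕-identityˡ 0P)

ΣFin-linear : ∀ k {f g h : Fin k → Poly} α β → (∀ t → f t ≈ g t ⊗ α ⊕ h t ⊗ β) →
  ΣFin k f ≈ ΣFin k g ⊗ α ⊕ ΣFin k h ⊗ β
ΣFin-linear zero    α β _ = ≈-sym (solve 2 (λ α β → con 0 :* α :+ con 0 :* β := con 0) ≈-refl α β)
ΣFin-linear (suc k) {f} {g} {h} α β f≈ =
  ≈-trans (⊕-cong (f≈ zero) (ΣFin-linear k α β (f≈ ∘ suc)))
    (solve 6 (λ g₀ h₀ G H α β → (g₀ :* α :+ h₀ :* β) :+ (G :* α :+ H :* β)
                               := (g₀ :+ G) :* α :+ (h₀ :+ H) :* β)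
       ≈-refl (g zero) (h zero) (ΣFin k (g ∘ suc)) (ΣFin k (h ∘ suc)) α β)

ΣFin-adjacent-cancel : ∀ n (f : Fin (suc n) → Poly) (i : Fin n) → f (inject₁ i) ⊕ f (suc i) ≈ 0P →
  (∀ t → t ≢ inject₁ i → t ≢ suc i → f t ≈ 0P) → ΣFin (suc n) f ≈ 0P
ΣFin-adjacent-cancel (suc n) f zero    pair≈0 rest≈0 =
  ≈-trans (≈-sym (⊕-assoc (f zero) (f (suc zero)) _))
    (≈-trans (⊕-cong pair≈0 (ΣFin-zero n (λ t → rest≈0 (suc (suc t)) (λ ()) (λ ())))) (⊕-identityˡ 0P))
ΣFin-adjacent-cancel (suc n) f (suc i) pair≈0 rest≈0 =
  ≈-trans (⊕-cong (rest≈0 zero (λ ()) (λ ()))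
                  (ΣFin-adjacent-cancel n (f ∘ suc) i pair≈0
                     (λ t t≢i t≢i+1 → rest≈0 (suc t) (t≢i ∘ Finₚ.suc-injective)
                                                     (t≢i+1 ∘ Finₚ.suc-injective))))
    (⊕-identityˡ 0P)

SquareMatrix : ℕ → Set
SquareMatrix k = Fin k → Fin k → Poly

minor : ∀ {k} → Fin (suc k) → SquareMatrix (suc k) → SquareMatrix k
minor t M r s = M (suc r) (punchIn t s)

det-cong : ∀ k {M N : SquareMatrix k} → (∀ r s → M r s ≈ N r s) → det k M ≈ det k N
det-cong zero    M≈N = ≈-refl
det-cong (suc k) M≈N = ΣFin-cong (suc k) λ t →
  signed-cong (toℕ t) (⊗-cong (M≈N zero t) (det-cong k (λ r s → M≈N (suc r) (punchIn t s))))

AgreeOffColumn : ∀ {k} → Fin k → SquareMatrix k → SquareMatrix k → Set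
AgreeOffColumn q M N = ∀ r s → s ≢ q → M r s ≈ N r s

AgreeOffColumn-minor : ∀ {k} {q : Fin (suc k)} {M N : SquareMatrix (suc k)} (t : Fin (suc k)) (t≢q : t ≢ q) →
  AgreeOffColumn q M N → AgreeOffColumn (Fin.punchOut t≢q) (minor t M) (minor t N)
AgreeOffColumn-minor t t≢q M≈N r s s≢ =
  M≈N (suc r) (punchIn t s)
    (λ e → s≢ (Finₚ.punchIn-injective t s _ (trans e (sym (Finₚ.punchIn-punchOut t≢q)))))

det-linear : ∀ k (M M′ M″ : SquareMatrix k) (q : Fin k) (α β : Poly) →
  (∀ r → M r q ≈ M′ r q ⊗ α ⊕ M″ r q ⊗ β) → AgreeOffColumn q M M′ → AgreeOffColumn q M M″ →
  det k M ≈ det k M′ ⊗ α ⊕ det k M″ ⊗ β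
det-linear (suc k) M M′ M″ q α β col-q M≈M′ M≈M″ = ΣFin-linear (suc k) α β λ t →
  ≈-trans (signed-cong (toℕ t) (expansion-term t)) (signed-linear (toℕ t) _ _ α β)
  where
  expansion-term : ∀ t → M zero t ⊗ det k (minor t M) ≈
    (M′ zero t ⊗ det k (minor t M′)) ⊗ α ⊕ (M″ zero t ⊗ det k (minor t M″)) ⊗ β
  expansion-term t with t Fin.≟ q
  ... | yes refl = ≈-trans (⊗-congʳ (col-q zero))
    (≈-trans (solve 5 (λ a b α β D → (a :* α :+ b :* β) :* D := (a :* D) :* α :+ (b :* D) :* β)
               ≈-refl (M′ zero t) (M″ zero t) α β (det k (minor t M)))
             (⊕-cong (⊗-congʳ (⊗-congˡ (minor≈ M≈M′))) (⊗-congʳ (⊗-congˡ (minor≈ M≈M″)))))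
    where
    minor≈ : ∀ {N} → AgreeOffColumn t M N → det k (minor t M) ≈ det k (minor t N)
    minor≈ M≈N = det-cong k (λ r s → M≈N (suc r) (punchIn t s) (Finₚ.punchInᵢ≢i t s))
  ... | no t≢q = ≈-trans (⊗-congˡ minor-linear)
    (≈-trans (solve 5 (λ a D′ D″ α β → a :* (D′ :* α :+ D″ :* β)
                                     := (a :* D′) :* α :+ (a :* D″) :* β)
               ≈-refl (M zero t) (det k (minor t M′)) (det k (minor t M″)) α β)
             (⊕-cong (⊗-congʳ (⊗-congʳ (M≈M′ zero t t≢q)))
                     (⊗-congʳ (⊗-congʳ (M≈M″ zero t t≢q)))))
    where
    minor-linear : det k (minor t M) ≈ det k (minor t M′) ⊗ α ⊕ det k (minor t M″) ⊗ β
    minor-linear = det-linear k (minor t M) (minor t M′) (minor t M″) (Fin.punchOut t≢q) α β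
      (λ r → subst (λ c → M (suc r) c ≈ M′ (suc r) c ⊗ α ⊕ M″ (suc r) c ⊗ β)
                   (sym (Finₚ.punchIn-punchOut t≢q)) (col-q (suc r)))
      (AgreeOffColumn-minor t t≢q M≈M′) (AgreeOffColumn-minor t t≢q M≈M″)

det-zero-column : ∀ k (M : SquareMatrix k) (q : Fin k) → (∀ r → M r q ≈ 0P) → det k M ≈ 0P
det-zero-column k M q col≈0 =
  ≈-trans (det-linear k M M M q 0P 0P (λ r → ≈-trans (col≈0 r) (≈-sym (zero≈ (M r q))))
                      (λ _ _ _ → ≈-refl) (λ _ _ _ → ≈-refl))
          (zero≈ (det k M))
  where
  zero≈ : ∀ x → x ⊗ 0P ⊕ x ⊗ 0P ≈ 0P
  zero≈ = solve 1 (λ x → x :* con 0 :+ x :* con 0 := con 0) ≈-refl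

punchIn-avoiding-adjacent : ∀ {n} (t : Fin (suc (suc n))) (i : Fin (suc n)) → t ≢ inject₁ i → t ≢ suc i →
  Σ[ i′ ∈ Fin n ] punchIn t (inject₁ i′) ≡ inject₁ i × punchIn t (suc i′) ≡ suc i
punchIn-avoiding-adjacent zero          zero    t≢i _     = ⊥-elim (t≢i refl)
punchIn-avoiding-adjacent zero          (suc i) _   _     = i , refl , refl
punchIn-avoiding-adjacent (suc zero)    zero    _   t≢i+1 = ⊥-elim (t≢i+1 refl)
punchIn-avoiding-adjacent {suc n} (suc (suc t)) zero _ _  = zero , refl , refl
punchIn-avoiding-adjacent {suc n} (suc t) (suc i) t≢i t≢i+1
  with punchIn-avoiding-adjacent t i (t≢i ∘ cong suc) (t≢i+1 ∘ cong suc)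
... | i′ , e₁ , e₂ = suc i′ , cong suc e₁ , cong suc e₂

punchIn-adjacent : ∀ {n} (i s : Fin n) →
  punchIn (inject₁ i) s ≡ punchIn (suc i) s ⊎
  (punchIn (inject₁ i) s ≡ suc i × punchIn (suc i) s ≡ inject₁ i)
punchIn-adjacent zero    zero    = inj₂ (refl , refl)
punchIn-adjacent zero    (suc s) = inj₁ refl
punchIn-adjacent (suc i) zero    = inj₁ refl
punchIn-adjacent (suc i) (suc s) with punchIn-adjacent i s
... | inj₁ e          = inj₁ (cong suc e)
... | inj₂ (e₁ , e₂) = inj₂ (cong suc e₁ , cong suc e₂)

-- In the expansion along the first row the terms for columns i and i + 1 cancel (their minors agree
-- and their signs differ); every other term has a minor with two equal adjacent columns.
det-adjacent-columns-equal : ∀ n (M : SquareMatrix (suc n)) (i : Fin n) →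
  (∀ r → M r (inject₁ i) ≈ M r (suc i)) → det (suc n) M ≈ 0P
det-adjacent-columns-equal (suc n) M i cols≈ = ΣFin-adjacent-cancel (suc n) term i pair≈0 rest≈0
  where
  term : Fin (suc (suc n)) → Poly
  term t = signed (toℕ t) (M zero t ⊗ det (suc n) (minor t M))
  rest≈0 : ∀ t → t ≢ inject₁ i → t ≢ suc i → term t ≈ 0P
  rest≈0 t t≢i t≢i+1 with punchIn-avoiding-adjacent t i t≢i t≢i+1
  ... | i′ , e₁ , e₂ = signed-zero (toℕ t) (≈-trans (⊗-congˡ minor≈0) (⊗-zeroʳ _))
    where
    minor≈0 : det (suc n) (minor t M) ≈ 0P
    minor≈0 = det-adjacent-columns-equal n (minor t M) i′ λ r →
      subst₂ (λ c d → M (suc r) c ≈ M (suc r) d) (sym e₁) (sym e₂) (cols≈ (suc r))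
  minors≈ : ∀ r s → minor (inject₁ i) M r s ≈ minor (suc i) M r s
  minors≈ r s with punchIn-adjacent i s
  ... | inj₁ e          = ≡⇒≈ (cong (M (suc r)) e)
  ... | inj₂ (e₁ , e₂) rewrite e₁ | e₂ = ≈-sym (cols≈ (suc r))
  pair≈0 : term (inject₁ i) ⊕ term (suc i) ≈ 0P
  pair≈0 rewrite Finₚ.toℕ-inject₁ i =
    ≈-trans (⊕-cong (signed-cong (toℕ i) (⊗-cong (cols≈ zero) (det-cong (suc n) minors≈))) ≈-refl)
            (≈-trans (⊕-comm _ _) (signed-suc-cancel (toℕ i) _))

-- Total positivity

1ᴹ : Matrix
1ᴹ = diagM (λ _ → 1P)

1ᴹ-diagonal : ∀ i → 1ᴹ i i ≡ 1P
1ᴹ-diagonal i with i ≟ i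
... | yes _  = refl
... | no i≢i = ⊥-elim (i≢i refl)

1ᴹ-off-diagonal : ∀ {i j} → i ≢ j → 1ᴹ i j ≡ 0P
1ᴹ-off-diagonal {i} {j} i≢j with i ≟ j
... | yes i≡j = ⊥-elim (i≢j i≡j)
... | no _    = refl

1ᴹ-suc : ∀ i j → 1ᴹ (suc i) (suc j) ≡ 1ᴹ i j
1ᴹ-suc i j with i ≟ j
... | yes refl = 1ᴹ-diagonal (suc i)
... | no i≢j   = 1ᴹ-off-diagonal (i≢j ∘ ℕₚ.suc-injective)

NonnegCoeffs-1ᴹ : ∀ i j → NonnegCoeffs (1ᴹ i j)
NonnegCoeffs-1ᴹ i j with i ≟ j
... | yes _ = NonnegCoeffs-const 1
... | no _  = NonnegCoeffs-const 0

punchIn-suc-zero : ∀ {k} (t : Fin k) → Σ[ s ∈ Fin k ] punchIn (suc t) s ≡ zero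
punchIn-suc-zero zero    = zero , refl
punchIn-suc-zero (suc _) = zero , refl

StrictlyIncreasing-suc : ∀ {k} {r : Fin (suc k) → ℕ} → StrictlyIncreasing r → StrictlyIncreasing (r ∘ suc)
StrictlyIncreasing-suc r↑ p q p<q = r↑ (suc p) (suc q) (s≤s p<q)

-- Expanding along the first row, only the first term survives: the other terms have r₀ ≠ c_t, or
-- r₀ = c_t and then the minor's first column c₀ < r₀ < r_p meets no diagonal entry.
1ᴹ-coeffTP : CoeffTP 1ᴹ
1ᴹ-coeffTP zero    r c r↑ c↑ = NonnegCoeffs-const 1
1ᴹ-coeffTP (suc k) r c r↑ c↑ =
  NonnegCoeffs-resp-≈
    (≈-sym (≈-trans (⊕-cong ≈-refl (ΣFin-zero k later-terms≈0)) (⊕-identityʳ first-term)))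
    (NonnegCoeffs-⊗ (1ᴹ (r zero) (c zero)) minor₀₀ (NonnegCoeffs-1ᴹ (r zero) (c zero))
      (1ᴹ-coeffTP k (r ∘ suc) (c ∘ suc) (StrictlyIncreasing-suc r↑) (StrictlyIncreasing-suc c↑)))
  where
  minor₀₀ first-term : Poly
  minor₀₀ = det k (λ p q → 1ᴹ (r (suc p)) (c (suc q)))
  first-term = 1ᴹ (r zero) (c zero) ⊗ minor₀₀
  later-terms≈0 : ∀ t → signed (suc (toℕ t))
    (1ᴹ (r zero) (c (suc t)) ⊗ det k (λ p s → 1ᴹ (r (suc p)) (c (punchIn (suc t) s)))) ≈ 0P
  later-terms≈0 t = signed-zero (suc (toℕ t)) (term≈0 (r zero ≟ c (suc t)))
    where
    term≈0 : Dec (r zero ≡ c (suc t)) →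
       1ᴹ (r zero) (c (suc t)) ⊗ det k (λ p s → 1ᴹ (r (suc p)) (c (punchIn (suc t) s))) ≈ 0P
    term≈0 (no r₀≢c)  = ≈-trans (⊗-congʳ (≡⇒≈ (1ᴹ-off-diagonal r₀≢c))) (⊗-zeroˡ _)
    term≈0 (yes r₀≡c) = ≈-trans (⊗-congˡ minor≈0) (⊗-zeroʳ _)
      where
      c₀<r : ∀ p → c zero < r (suc p)
      c₀<r p = ℕₚ.<-trans (c↑ zero (suc t) (s≤s z≤n))
                          (subst (_< r (suc p)) r₀≡c (r↑ zero (suc p) (s≤s z≤n)))
      minor≈0 : det k (λ p s → 1ᴹ (r (suc p)) (c (punchIn (suc t) s))) ≈ 0P
      minor≈0 with punchIn-suc-zero t
      ... | s₀ , s₀↦0 = det-zero-column k _ s₀ λ p → ≡⇒≈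
        (trans (cong (λ u → 1ᴹ (r (suc p)) (c u)) s₀↦0) (1ᴹ-off-diagonal (ℕₚ.>⇒≢ (c₀<r p))))

NonDecreasing : ∀ {k} → (Fin k → ℕ) → Set
NonDecreasing {k} c = ∀ (p q : Fin k) → p Fin.< q → c p ≤ c q

strictlyIncreasing⊎adjacent-equal : ∀ n (c : Fin (suc n) → ℕ) → NonDecreasing c →
  StrictlyIncreasing c ⊎ Σ[ i ∈ Fin n ] c (inject₁ i) ≡ c (suc i)
strictlyIncreasing⊎adjacent-equal zero    c _ = inj₁ λ { zero zero () ; zero (suc ()) _ ; (suc ()) _ _ }
strictlyIncreasing⊎adjacent-equal (suc n) c c↑ with c zero ≟ c (suc zero)
... | yes c₀≡c₁ = inj₂ (zero , c₀≡c₁)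
... | no c₀≢c₁
  with strictlyIncreasing⊎adjacent-equal n (c ∘ suc) (λ p q p<q → c↑ (suc p) (suc q) (s≤s p<q))
...   | inj₂ (i , e) = inj₂ (suc i , e)
...   | inj₁ c∘suc↑ = inj₁ c↑↑
  where
  c₀<c₁ : c zero < c (suc zero)
  c₀<c₁ = ℕₚ.≤∧≢⇒< (c↑ zero (suc zero) (s≤s z≤n)) c₀≢c₁
  c↑↑ : StrictlyIncreasing c
  c↑↑ zero    (suc zero)    _         = c₀<c₁
  c↑↑ zero    (suc (suc q)) _         = ℕₚ.<-trans c₀<c₁ (c∘suc↑ zero (suc q) (s≤s z≤n))
  c↑↑ (suc p) (suc q)       (s≤s p<q) = c∘suc↑ p q p<q

-- A repeated column index gives two equal adjacent columns, hence a vanishing minor.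
CoeffTP-nonDecreasing-columns : ∀ A → CoeffTP A → ∀ k (r c : Fin k → ℕ) →
  StrictlyIncreasing r → NonDecreasing c →
  NonnegCoeffs (det k (λ p q → A (r p) (c q)))
CoeffTP-nonDecreasing-columns A tpA zero    r c r↑ c↑ = tpA zero r c r↑ (λ ())
CoeffTP-nonDecreasing-columns A tpA (suc n) r c r↑ c↑ with strictlyIncreasing⊎adjacent-equal n c c↑
... | inj₁ c↑↑     = tpA (suc n) r c r↑ c↑↑
... | inj₂ (i , e) = NonnegCoeffs-resp-≈
  (≈-sym (det-adjacent-columns-equal n (λ p q → A (r p) (c q)) i (λ p → ≡⇒≈ (cong (A (r p)) e))))
  (NonnegCoeffs-const 0)

CoeffTP-resp-≈ : ∀ {A B : Matrix} → (∀ i j → A i j ≈ B i j) → CoeffTP A → CoeffTP B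
CoeffTP-resp-≈ A≈B tpA k r c r↑ c↑ =
  NonnegCoeffs-resp-≈ (det-cong k (λ p q → A≈B (r p) (c q))) (tpA k r c r↑ c↑)

-- Recombining columns preserves total positivity

-- (l , w) stands for w times column l.
Combination : Set
Combination = List (ℕ × Poly)

combine : Combination → (ℕ → Poly) → Poly
combine []             row = 0P
combine ((l , w) ∷ xs) row = row l ⊗ w ⊕ combine xs row

indices : Combination → List ℕ
indices = map proj₁

NonnegWeights : Combination → Set
NonnegWeights = All (NonnegCoeffs ∘ proj₂)

Nonempty : Combination → Set
Nonempty xs = Σ[ b ∈ ℕ ] b ∈ indices xs

_≼_ : Combination → Combination → Set
xs ≼ ys = ∀ {a b} → a ∈ indices xs → b ∈ indices ys → a ≤ b

Staircase : {I : Set} → (I → I → Set) → (I → Combination) → Set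
Staircase _<ᵢ_ W = ∀ p q → p <ᵢ q → W p ≼ W q

-- A ◂ W is A times the matrix whose column n holds the weights W n.
_◂_ : Matrix → (ℕ → Combination) → Matrix
(A ◂ W) i n = combine (W n) (A i)

module _ {k : ℕ} (V : Fin k → Combination) (q₀ : Fin k) (xs : Combination) where

  replaced : Fin k → Combination
  replaced = updateAt V q₀ (λ _ → xs)

  replaced-here : replaced q₀ ≡ xs
  replaced-here = updateAt-updates q₀ V

  replaced-there : ∀ q → q ≢ q₀ → replaced q ≡ V q
  replaced-there q q≢q₀ = updateAt-minimal q q₀ V q≢q₀

  Staircase-replaced : (∀ {a} → a ∈ indices xs → a ∈ indices (V q₀)) →
    Staircase Fin._<_ V → Staircase Fin._<_ replaced
  Staircase-replaced xs⊆ V↑ p q p<q a∈ b∈ = V↑ p q p<q (shrink p a∈) (shrink q b∈)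
    where
    shrink : ∀ q {a} → a ∈ indices (replaced q) → a ∈ indices (V q)
    shrink q a∈ with q Fin.≟ q₀
    ... | yes refl  = xs⊆ (subst (λ ys → _ ∈ indices ys) replaced-here a∈)
    ... | no q≢q₀   = subst (λ ys → _ ∈ indices ys) (replaced-there q q≢q₀) a∈

  NonnegWeights-replaced : NonnegWeights xs → (∀ q → NonnegWeights (V q)) → ∀ q → NonnegWeights (replaced q)
  NonnegWeights-replaced xs≥0 V≥0 q with q Fin.≟ q₀
  ... | yes refl = subst NonnegWeights (sym replaced-here) xs≥0
  ... | no q≢q₀  = subst NonnegWeights (sym (replaced-there q q≢q₀)) (V≥0 q)

SingleColumnsFrom : ∀ {k} → ℕ → (Fin k → Combination) → Set
SingleColumnsFrom t V = ∀ q → t ≤ toℕ q → Σ[ l ∈ ℕ ] V q ≡ (l , 1P) ∷ []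

SingleColumnsFrom-replaced : ∀ {k t} (V : Fin k → Combination) q₀ xs → toℕ q₀ < t →
  SingleColumnsFrom t V → SingleColumnsFrom t (replaced V q₀ xs)
SingleColumnsFrom-replaced V q₀ xs q₀<t single q t≤q =
  let l , Vq≡ = single q t≤q
  in  l , trans (replaced-there V q₀ xs q (λ { refl → ℕₚ.<⇒≱ q₀<t t≤q })) Vq≡

SingleColumnsFrom-replaced-single : ∀ {k t} (V : Fin k → Combination) q₀ l → toℕ q₀ ≡ t →
  SingleColumnsFrom (suc t) V → SingleColumnsFrom t (replaced V q₀ ((l , 1P) ∷ []))
SingleColumnsFrom-replaced-single V q₀ l refl single q q₀≤q with q Fin.≟ q₀
... | yes refl = l , replaced-here V q₀ _
... | no q≢q₀  = SingleColumnsFrom-replaced V q₀ _ (ℕₚ.n<1+n _) single q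
                   (ℕₚ.≤∧≢⇒< q₀≤q (q≢q₀ ∘ Finₚ.toℕ-injective ∘ sym))

module _ (A : Matrix) {k : ℕ} (r : Fin k → ℕ) where

  minorOf : (Fin k → Combination) → SquareMatrix k
  minorOf V p q = combine (V q) (A (r p))

  det-minorOf-[] : ∀ V q₀ → V q₀ ≡ [] → det k (minorOf V) ≈ 0P
  det-minorOf-[] V q₀ V-q₀ =
    det-zero-column k (minorOf V) q₀ (λ p → ≡⇒≈ (cong (λ xs → combine xs (A (r p))) V-q₀))

  det-minorOf-∷ : ∀ V q₀ {l w xs} → V q₀ ≡ (l , w) ∷ xs →
    det k (minorOf V) ≈
    det k (minorOf (replaced V q₀ ((l , 1P) ∷ []))) ⊗ w ⊕ det k (minorOf (replaced V q₀ xs)) ⊗ 1P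
  det-minorOf-∷ V q₀ {l} {w} {xs} V-q₀ = det-linear k _ _ _ q₀ w 1P column-q₀ (agree _) (agree _)
    where
    column-q₀ : ∀ p → minorOf V p q₀ ≈
      minorOf (replaced V q₀ ((l , 1P) ∷ [])) p q₀ ⊗ w ⊕ minorOf (replaced V q₀ xs) p q₀ ⊗ 1P
    column-q₀ p rewrite V-q₀ | replaced-here V q₀ ((l , 1P) ∷ []) | replaced-here V q₀ xs =
      solve 3 (λ a w s → a :* w :+ s := (a :* con 1 :+ con 0) :* w :+ s :* con 1)
        ≈-refl (A (r p) l) w (combine xs (A (r p)))
    agree : ∀ ys → AgreeOffColumn q₀ (minorOf V) (minorOf (replaced V q₀ ys))
    agree ys p q q≢q₀ rewrite replaced-there V q₀ ys q q≢q₀ = ≈-refl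

-- Expand the columns of a minor one at a time by multilinearity: every resulting term is a minor of A
-- with nondecreasing column indices and a nonnegative weight.
module _ (A : Matrix) (tpA : CoeffTP A) {k : ℕ} (r : Fin k → ℕ) (r↑ : StrictlyIncreasing r) where

  NonnegMinorsFrom : ℕ → Set
  NonnegMinorsFrom t = ∀ V → Staircase Fin._<_ V → (∀ q → NonnegWeights (V q)) → SingleColumnsFrom t V →
    NonnegCoeffs (det k (minorOf A r V))

  nonnegMinorsFrom-zero : NonnegMinorsFrom 0
  nonnegMinorsFrom-zero V V↑ _ single = NonnegCoeffs-resp-≈ (det-cong k entries)
    (CoeffTP-nonDecreasing-columns A tpA k r column r↑ (λ p q p<q → V↑ p q p<q (column∈ p) (column∈ q)))
    where
    column : Fin k → ℕ
    column q = proj₁ (single q z≤n)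
    entries : ∀ p q → A (r p) (column q) ≈ minorOf A r V p q
    entries p q rewrite proj₂ (single q z≤n) = ≈-sym (≈-trans (⊕-identityʳ _) (⊗-identityʳ _))
    column∈ : ∀ q → column q ∈ indices (V q)
    column∈ q rewrite proj₂ (single q z≤n) = here refl

  nonnegMinorsFrom-suc : ∀ t → t < k → NonnegMinorsFrom t → NonnegMinorsFrom (suc t)
  nonnegMinorsFrom-suc t t<k ih V = expand (V q₀) V refl
    where
    q₀ : Fin k
    q₀ = fromℕ< t<k
    q₀≡t : toℕ q₀ ≡ t
    q₀≡t = Finₚ.toℕ-fromℕ< t<k
    expand : ∀ xs V → V q₀ ≡ xs → Staircase Fin._<_ V → (∀ q → NonnegWeights (V q)) →
      SingleColumnsFrom (suc t) V → NonnegCoeffs (det k (minorOf A r V))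
    expand [] V V-q₀ _ _ _ = NonnegCoeffs-resp-≈ (≈-sym (det-minorOf-[] A r V q₀ V-q₀)) (NonnegCoeffs-const 0)
    expand ((l , w) ∷ xs) V V-q₀ V↑ V≥0 single =
      NonnegCoeffs-resp-≈ (≈-sym (det-minorOf-∷ A r V q₀ V-q₀))
        (NonnegCoeffs-⊕ (det k (minorOf A r V₁) ⊗ w) (det k (minorOf A r V₂) ⊗ 1P)
          (NonnegCoeffs-⊗ (det k (minorOf A r V₁)) w det₁≥0 (All.head V-q₀≥0))
          (NonnegCoeffs-⊗ (det k (minorOf A r V₂)) 1P det₂≥0 (NonnegCoeffs-const 1)))
      where
      V₁ V₂ : Fin k → Combination
      V₁ = replaced V q₀ ((l , 1P) ∷ [])
      V₂ = replaced V q₀ xs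
      V-q₀≥0 : NonnegWeights ((l , w) ∷ xs)
      V-q₀≥0 = subst NonnegWeights V-q₀ (V≥0 q₀)
      ⊆V-q₀ : ∀ {ys a} → (a ∈ indices ys → a ∈ indices ((l , w) ∷ xs)) →
        a ∈ indices ys → a ∈ indices (V q₀)
      ⊆V-q₀ ⊆ a∈ = subst (λ ys → _ ∈ indices ys) (sym V-q₀) (⊆ a∈)
      det₁≥0 : NonnegCoeffs (det k (minorOf A r V₁))
      det₁≥0 = ih V₁ (Staircase-replaced V q₀ _ (⊆V-q₀ {(l , 1P) ∷ []} λ { (here e) → here e }) V↑)
                     (NonnegWeights-replaced V q₀ _ (NonnegCoeffs-const 1 ∷ []) V≥0)
                     (SingleColumnsFrom-replaced-single V q₀ l q₀≡t single)
      det₂≥0 : NonnegCoeffs (det k (minorOf A r V₂))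
      det₂≥0 = expand xs V₂ (replaced-here V q₀ xs) (Staircase-replaced V q₀ xs (⊆V-q₀ there) V↑)
        (NonnegWeights-replaced V q₀ xs (All.tail V-q₀≥0) V≥0)
        (SingleColumnsFrom-replaced V q₀ xs (ℕₚ.≤-reflexive (cong suc q₀≡t)) single)

  nonnegMinorsFrom : ∀ t → t ≤ k → NonnegMinorsFrom t
  nonnegMinorsFrom zero    _   = nonnegMinorsFrom-zero
  nonnegMinorsFrom (suc t) t<k = nonnegMinorsFrom-suc t t<k (nonnegMinorsFrom t (ℕₚ.<⇒≤ t<k))

◂-coeffTP : ∀ A (W : ℕ → Combination) → CoeffTP A → Staircase _<_ W → (∀ n → NonnegWeights (W n)) →
  CoeffTP (A ◂ W)
◂-coeffTP A W tpA W↑ W≥0 k r c r↑ c↑ =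
  nonnegMinorsFrom A tpA r r↑ k ℕₚ.≤-refl (W ∘ c)
    (λ p q p<q → W↑ (c p) (c q) (c↑ p q p<q)) (W≥0 ∘ c)
    (λ q k≤q → ⊥-elim (ℕₚ.<⇒≱ (Finₚ.toℕ<n q) k≤q))

≼-trans : ∀ {xs ys zs} → Nonempty ys → xs ≼ ys → ys ≼ zs → xs ≼ zs
≼-trans (b , b∈) xs≼ys ys≼zs a∈ c∈ = ℕₚ.≤-trans (xs≼ys a∈ b∈) (ys≼zs b∈ c∈)

≼-via : ∀ xs ys m → All (_≤ m) (indices xs) → All (m ≤_) (indices ys) → xs ≼ ys
≼-via _ _ m xs≤m m≤ys a∈ b∈ = ℕₚ.≤-trans (All.lookup xs≤m a∈) (All.lookup m≤ys b∈)

staircase-adjacent : ∀ (W : ℕ → Combination) → (∀ n → Nonempty (W n)) →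
  (∀ n → W n ≼ W (suc n)) → Staircase _<_ W
staircase-adjacent W nonempty adjacent n m n<m = go (ℕₚ.≤⇒≤′ n<m)
  where
  go : ∀ {m} → suc n ℕ.≤′ m → W n ≼ W m
  go ℕ.≤′-refl         = adjacent n
  go (ℕ.≤′-step n<m′) = ≼-trans (nonempty _) (go n<m′) (adjacent _)

dbl : ℕ → ℕ
dbl zero    = zero
dbl (suc l) = suc (suc (dbl l))

interleave : ∀ {A : Set} → (ℕ → A) → (ℕ → A) → ℕ → A
interleave E O zero          = E 0
interleave E O (suc zero)    = O 0
interleave E O (suc (suc n)) = interleave (E ∘ suc) (O ∘ suc) n

interleave-even : ∀ {A : Set} (E O : ℕ → A) l → interleave E O (dbl l) ≡ E l
interleave-even E O zero    = refl
interleave-even E O (suc l) = interleave-even (E ∘ suc) (O ∘ suc) l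

interleave-odd : ∀ {A : Set} (E O : ℕ → A) l → interleave E O (suc (dbl l)) ≡ O l
interleave-odd E O zero    = refl
interleave-odd E O (suc l) = interleave-odd (E ∘ suc) (O ∘ suc) l

interleave-∀ : ∀ {A : Set} (Q : A → Set) {E O : ℕ → A} → (∀ l → Q (E l)) → (∀ l → Q (O l)) →
  ∀ n → Q (interleave E O n)
interleave-∀ Q QE QO zero          = QE 0
interleave-∀ Q QE QO (suc zero)    = QO 0
interleave-∀ Q QE QO (suc (suc n)) = interleave-∀ Q (QE ∘ suc) (QO ∘ suc) n

interleave-adjacent : ∀ {E O : ℕ → Combination} → (∀ l → E l ≼ O l) → (∀ l → O l ≼ E (suc l)) →
  ∀ n → interleave E O n ≼ interleave E O (suc n)
interleave-adjacent E≼O O≼E zero          = E≼O 0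
interleave-adjacent E≼O O≼E (suc zero)    = O≼E 0
interleave-adjacent E≼O O≼E (suc (suc n)) = interleave-adjacent (E≼O ∘ suc) (O≼E ∘ suc) n

staircase-interleave : ∀ (E O : ℕ → Combination) →
  (∀ l → Nonempty (E l)) → (∀ l → Nonempty (O l)) →
  (∀ l → E l ≼ O l) → (∀ l → O l ≼ E (suc l)) → Staircase _<_ (interleave E O)
staircase-interleave E O E≢[] O≢[] E≼O O≼E =
  staircase-adjacent (interleave E O) (interleave-∀ Nonempty E≢[] O≢[])
    (interleave-adjacent E≼O O≼E)

-- The factorisation

lowerBidiag≈ : ∀ x y i j → lowerBidiag x y i j ≈ 1ᴹ i j ⊗ x j ⊕ 1ᴹ i (suc j) ⊗ y (suc j)
lowerBidiag≈ x y i j with i ≟ j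
... | yes refl rewrite 1ᴹ-off-diagonal (ℕₚ.<⇒≢ (ℕₚ.n<1+n i)) =
  solve 2 (λ a b → a := con 1 :* a :+ con 0 :* b) ≈-refl (x i) (y (suc i))
... | no i≢j with i ≟ suc j
...   | yes refl =
  solve 2 (λ a b → b := con 0 :* a :+ con 1 :* b) ≈-refl (x j) (y (suc j))
...   | no i≢j+1 =
  solve 2 (λ a b → con 0 := con 0 :* a :+ con 0 :* b) ≈-refl (x j) (y (suc j))

upperBidiag≈ : ∀ x y i j → upperBidiag x y i j ≈ 1ᴹ i j ⊗ x j ⊕ 1ᴹ (suc i) j ⊗ y j
upperBidiag≈ x y i j with i ≟ j
... | yes refl rewrite 1ᴹ-off-diagonal (ℕₚ.1+n≢n {i}) =
  solve 2 (λ a b → a := con 1 :* a :+ con 0 :* b) ≈-refl (x i) (y i)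
... | no i≢j with suc i ≟ j
...   | yes refl =
  solve 2 (λ a b → b := con 0 :* a :+ con 1 :* b) ≈-refl (x (suc i)) (y (suc i))
...   | no i+1≢j =
  solve 2 (λ a b → con 0 := con 0 :* a :+ con 0 :* b) ≈-refl (x j) (y j)

diagM≈ : ∀ x i j → diagM x i j ≈ 1ᴹ i j ⊗ x j
diagM≈ x i j with i ≟ j
... | yes refl = ≈-sym (⊗-identityˡ (x i))
... | no i≢j  = ≈-sym (⊗-zeroˡ (x j))

Σ<-cong : ∀ n {f g : ℕ → Poly} → (∀ m → f m ≈ g m) → Σ< n f ≈ Σ< n g
Σ<-cong zero    f≈g = ≈-refl
Σ<-cong (suc n) f≈g = ⊕-cong (Σ<-cong n f≈g) (f≈g n)

Σ<-zero : ∀ n {f : ℕ → Poly} → (∀ m → f m ≈ 0P) → Σ< n f ≈ 0P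
Σ<-zero zero    f≈0 = ≈-refl
Σ<-zero (suc n) f≈0 = ≈-trans (⊕-cong (Σ<-zero n f≈0) (f≈0 n)) (⊕-identityˡ 0P)

Σ<-linear : ∀ n (g h : ℕ → Poly) α β →
  Σ< n (λ m → g m ⊗ α ⊕ h m ⊗ β) ≈ Σ< n g ⊗ α ⊕ Σ< n h ⊗ β
Σ<-linear zero    g h α β = ≈-sym (solve 2 (λ α β → con 0 :* α :+ con 0 :* β := con 0) ≈-refl α β)
Σ<-linear (suc n) g h α β =
  ≈-trans (⊕-cong (Σ<-linear n g h α β) ≈-refl)
    (solve 6 (λ g₀ h₀ G H α β → (G :* α :+ H :* β) :+ (g₀ :* α :+ h₀ :* β)
                               := (G :+ g₀) :* α :+ (H :+ h₀) :* β)
       ≈-refl (g n) (h n) (Σ< n g) (Σ< n h) α β)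

Σ<-1ᴹ-beyond : ∀ n t (f : ℕ → Poly) → n ≤ t → Σ< n (λ m → f m ⊗ 1ᴹ m t) ≈ 0P
Σ<-1ᴹ-beyond zero    t f _    = ≈-refl
Σ<-1ᴹ-beyond (suc n) t f n<t rewrite 1ᴹ-off-diagonal (ℕₚ.<⇒≢ n<t) =
  ≈-trans (⊕-cong (Σ<-1ᴹ-beyond n t f (ℕₚ.<⇒≤ n<t)) (⊗-zeroʳ (f n))) (⊕-identityˡ 0P)

Σ<-1ᴹ-within : ∀ n t (f : ℕ → Poly) → t < n → Σ< n (λ m → f m ⊗ 1ᴹ m t) ≈ f t
Σ<-1ᴹ-within (suc n) t f (s≤s t≤n) with t ≟ n
... | yes refl rewrite 1ᴹ-diagonal t =
  ≈-trans (⊕-cong (Σ<-1ᴹ-beyond t t f ℕₚ.≤-refl) (⊗-identityʳ (f t))) (⊕-identityˡ (f t))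
... | no t≢n rewrite 1ᴹ-off-diagonal (t≢n ∘ sym) =
  ≈-trans (⊕-cong (Σ<-1ᴹ-within n t f (ℕₚ.≤∧≢⇒< t≤n t≢n)) (⊗-zeroʳ (f n)))
          (⊕-identityʳ (f t))

Σ<-1ᴹ : ∀ n t (f : ℕ → Poly) → (∀ m → n ≤ m → f m ≈ 0P) →
  Σ< n (λ m → f m ⊗ 1ᴹ m t) ≈ f t
Σ<-1ᴹ n t f f≈0 with t ℕₚ.<? n
... | yes t<n = Σ<-1ᴹ-within n t f t<n
... | no t≮n  = ≈-trans (Σ<-1ᴹ-beyond n t f n≤t) (≈-sym (f≈0 t n≤t))
  where
  n≤t : n ≤ t
  n≤t = ℕₚ.≮⇒≥ t≮n

Σ<-⊗ʳ : ∀ n (g : ℕ → Poly) α → Σ< n (λ m → g m ⊗ α) ≈ Σ< n g ⊗ α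
Σ<-⊗ʳ zero    g α = ≈-sym (⊗-zeroˡ α)
Σ<-⊗ʳ (suc n) g α = ≈-trans (⊕-cong (Σ<-⊗ʳ n g α) ≈-refl) (≈-sym (⊗-distribʳ α (Σ< n g) (g n)))

⊗-distribˡ-pair : ∀ X a α b β → X ⊗ (a ⊗ α ⊕ b ⊗ β) ≈ (X ⊗ a) ⊗ α ⊕ (X ⊗ b) ⊗ β
⊗-distribˡ-pair = solve 5 (λ X a α b β → X :* (a :* α :+ b :* β) := (X :* a) :* α :+ (X :* b) :* β) ≈-refl

Σ<-⊗-lowerBidiag : ∀ n (X : ℕ → Poly) x y j → (∀ m → n ≤ m → X m ≈ 0P) →
  Σ< n (λ m → X m ⊗ lowerBidiag x y m j) ≈ X j ⊗ x j ⊕ X (suc j) ⊗ y (suc j)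
Σ<-⊗-lowerBidiag n X x y j X≈0 =
  ≈-trans (Σ<-cong n (λ m → ≈-trans (⊗-congˡ (lowerBidiag≈ x y m j)) (⊗-distribˡ-pair (X m) _ _ _ _)))
    (≈-trans (Σ<-linear n _ _ (x j) (y (suc j)))
      (⊕-cong (⊗-congʳ (Σ<-1ᴹ n j X X≈0)) (⊗-congʳ (Σ<-1ᴹ n (suc j) X X≈0))))

previous : (ℕ → Poly) → ℕ → Poly
previous X zero    = 0P
previous X (suc l) = X l

Σ<-⊗-upperBidiag : ∀ n (X : ℕ → Poly) x y l → (∀ m → n ≤ m → X m ≈ 0P) →
  Σ< n (λ m → X m ⊗ upperBidiag x y m l) ≈ X l ⊗ x l ⊕ previous X l ⊗ y l
Σ<-⊗-upperBidiag n X x y l X≈0 =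
  ≈-trans (Σ<-cong n (λ m → ≈-trans (⊗-congˡ (upperBidiag≈ x y m l)) (⊗-distribˡ-pair (X m) _ _ _ _)))
    (≈-trans (Σ<-linear n _ _ (x l) (y l))
      (⊕-cong (⊗-congʳ (Σ<-1ᴹ n l X X≈0)) (⊗-congʳ (shifted l))))
  where
  shifted : ∀ l → Σ< n (λ m → X m ⊗ 1ᴹ (suc m) l) ≈ previous X l
  shifted zero    = Σ<-zero n λ m →
    ≈-trans (≡⇒≈ (cong (X m ⊗_) (1ᴹ-off-diagonal (ℕₚ.1+n≢0 {m})))) (⊗-zeroʳ (X m))
  shifted (suc l) = ≈-trans (Σ<-cong n (λ m → ≡⇒≈ (cong (X m ⊗_) (1ᴹ-suc m l)))) (Σ<-1ᴹ n l X X≈0)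

Σ<-⊗-diagM : ∀ n (X : ℕ → Poly) x j → (∀ m → n ≤ m → X m ≈ 0P) →
  Σ< n (λ m → X m ⊗ diagM x m j) ≈ X j ⊗ x j
Σ<-⊗-diagM n X x j X≈0 =
  ≈-trans (Σ<-cong n (λ m → ≈-trans (⊗-congˡ (diagM≈ x m j)) (≈-sym (⊗-assoc (X m) (1ᴹ m j) (x j)))))
    (≈-trans (Σ<-⊗ʳ n _ (x j)) (⊗-congʳ (Σ<-1ᴹ n j X X≈0)))

lowerBidiag-above-diagonal : ∀ x y {i m} → i < m → lowerBidiag x y i m ≈ 0P
lowerBidiag-above-diagonal x y {i} {m} i<m with i ≟ m
... | yes refl = ⊥-elim (ℕₚ.<-irrefl refl i<m)
... | no _ with i ≟ suc m
...   | yes refl = ⊥-elim (ℕₚ.<-asym (ℕₚ.n<1+n m) i<m)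
...   | no _     = ≈-refl

diagM-above-diagonal : ∀ x {i m} → i < m → diagM x i m ≈ 0P
diagM-above-diagonal x {i} {m} i<m with i ≟ m
... | yes refl = ⊥-elim (ℕₚ.<-irrefl refl i<m)
... | no _     = ≈-refl

L₁U : Matrix
L₁U = L₁ *ᴹ U

L₁U≈ : ∀ i l → L₁U i l ≈ L₁ i l ⊗ dV l ⊕ previous (L₁ i) l ⊗ cV l
L₁U≈ i l = Σ<-⊗-upperBidiag (suc (suc i)) (L₁ i) dV cV l
  (λ m i+2≤m → lowerBidiag-above-diagonal aV bV (ℕₚ.<⇒≤ i+2≤m))

L₁U-above-superdiagonal : ∀ i {l} → suc i < l → L₁U i l ≈ 0P
L₁U-above-superdiagonal i {suc l} (s≤s i<l) =
  ≈-trans (L₁U≈ i (suc l))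
    (≈-trans (⊕-cong (⊗-congʳ (lowerBidiag-above-diagonal aV bV (ℕₚ.m<n⇒m<1+n i<l)))
                     (⊗-congʳ (lowerBidiag-above-diagonal aV bV i<l)))
      (solve 2 (λ d c → con 0 :* d :+ con 0 :* c := con 0) ≈-refl (dV (suc l)) (cV (suc l))))

P≈ : ∀ i j → P i j ≈ ((L₁U i j ⊗ eV j ⊕ L₁U i (suc j) ⊗ fV (suc j)) ⊕ L₁ i j ⊗ gV j) ⊕
                      (D₂ i j ⊗ eV j ⊕ D₂ i (suc j) ⊗ fV (suc j))
P≈ i j = ⊕-cong
  (⊕-cong (Σ<-⊗-lowerBidiag (suc (suc i)) (L₁U i) eV fV j (λ m i+2≤m → L₁U-above-superdiagonal i i+2≤m))
          (Σ<-⊗-diagM (suc (suc i)) (L₁ i) gV j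
             (λ m i+2≤m → lowerBidiag-above-diagonal aV bV (ℕₚ.<⇒≤ i+2≤m))))
  (Σ<-⊗-lowerBidiag (suc (suc i)) (D₂ i) eV fV j
     (λ m i+2≤m → diagM-above-diagonal hV (ℕₚ.<⇒≤ i+2≤m)))

-- B₁ = 1ᴹ ◂ W₁ has columns D₂₀, L₁₀, D₂₁, L₁₁, …
W₁-even W₁-odd W₁ : ℕ → Combination
W₁-even l = (l , hV l) ∷ []
W₁-odd  l = (l , aV l) ∷ (suc l , bV (suc l)) ∷ []
W₁ = interleave W₁-even W₁-odd

-- B₂ = B₁ ◂ W₂ has columns (D₂ + L₁U)₀, (L₁D₁)₀, (D₂ + L₁U)₁, (L₁D₁)₁, …
W₂-even W₂-odd W₂ : ℕ → Combination
W₂-even zero    = (0 , 1P) ∷ (1 , dV 0) ∷ []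
W₂-even (suc l) = (dbl (suc l) , 1P) ∷ (suc (dbl (suc l)) , dV (suc l)) ∷ (suc (dbl l) , cV (suc l)) ∷ []
W₂-odd l = (suc (dbl l) , gV l) ∷ []
W₂ = interleave W₂-even W₂-odd

-- B₂ ◂ W₃ = (D₂ + L₁U) L₂ + L₁D₁ = P
W₃ : ℕ → Combination
W₃ j = (dbl j , eV j) ∷ (suc (dbl j) , 1P) ∷ (dbl (suc j) , fV (suc j)) ∷ []

B₁ B₂ : Matrix
B₁ = 1ᴹ ◂ W₁
B₂ = B₁ ◂ W₂

B₁-even : ∀ i l → B₁ i (dbl l) ≈ D₂ i l
B₁-even i l = ≈-trans (≡⇒≈ (cong (λ xs → combine xs (1ᴹ i)) (interleave-even _ _ l)))
                      (≈-trans (⊕-identityʳ _) (≈-sym (diagM≈ hV i l)))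

B₁-odd : ∀ i l → B₁ i (suc (dbl l)) ≈ L₁ i l
B₁-odd i l = ≈-trans (≡⇒≈ (cong (λ xs → combine xs (1ᴹ i)) (interleave-odd _ _ l)))
                     (≈-trans (⊕-cong ≈-refl (⊕-identityʳ _)) (≈-sym (lowerBidiag≈ aV bV i l)))

B₂-even : ∀ i l → B₂ i (dbl l) ≈ D₂ i l ⊕ L₁U i l
B₂-even i l = ≈-trans (≡⇒≈ (cong (λ xs → combine xs (B₁ i)) (interleave-even _ _ l))) (even l)
  where
  even : ∀ l → combine (W₂-even l) (B₁ i) ≈ D₂ i l ⊕ L₁U i l
  even zero = ≈-trans
    (⊕-cong (⊗-congʳ (B₁-even i 0)) (⊕-cong (⊗-congʳ (B₁-odd i 0)) ≈-refl))
    (≈-trans (solve 4 (λ D L d c → D :* con 1 :+ (L :* d :+ con 0) := D :+ (L :* d :+ con 0 :* c))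
                ≈-refl (D₂ i 0) (L₁ i 0) (dV 0) (cV 0))
             (⊕-cong ≈-refl (≈-sym (L₁U≈ i 0))))
  even (suc l) = ≈-trans
    (⊕-cong (⊗-congʳ (B₁-even i (suc l)))
            (⊕-cong (⊗-congʳ (B₁-odd i (suc l))) (⊕-cong (⊗-congʳ (B₁-odd i l)) ≈-refl)))
    (≈-trans (solve 5 (λ D L L′ d c → D :* con 1 :+ (L :* d :+ (L′ :* c :+ con 0))
                                     := D :+ (L :* d :+ L′ :* c))
                ≈-refl (D₂ i (suc l)) (L₁ i (suc l)) (L₁ i l) (dV (suc l)) (cV (suc l)))
             (⊕-cong ≈-refl (≈-sym (L₁U≈ i (suc l)))))

B₂-odd : ∀ i l → B₂ i (suc (dbl l)) ≈ L₁ i l ⊗ gV l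
B₂-odd i l = ≈-trans (≡⇒≈ (cong (λ xs → combine xs (B₁ i)) (interleave-odd _ _ l)))
                     (≈-trans (⊕-identityʳ _) (⊗-congʳ (B₁-odd i l)))

B₂◂W₃≈P : ∀ i j → (B₂ ◂ W₃) i j ≈ P i j
B₂◂W₃≈P i j = ≈-trans
  (⊕-cong (⊗-congʳ (B₂-even i j))
          (⊕-cong (⊗-congʳ (B₂-odd i j)) (⊕-cong (⊗-congʳ (B₂-even i (suc j))) ≈-refl)))
  (≈-trans (solve 8 (λ D LU L g e D′ LU′ f →
              (D :+ LU) :* e :+ ((L :* g) :* con 1 :+ ((D′ :+ LU′) :* f :+ con 0))
              := ((LU :* e :+ LU′ :* f) :+ L :* g) :+ (D :* e :+ D′ :* f))
              ≈-refl (D₂ i j) (L₁U i j) (L₁ i j) (gV j) (eV j) (D₂ i (suc j)) (L₁U i (suc j)) (fV (suc j)))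
           (≈-sym (P≈ i j)))

W₁-staircase : Staircase _<_ W₁
W₁-staircase = staircase-interleave W₁-even W₁-odd (λ l → l , here refl) (λ l → l , here refl)
  (λ l → ≼-via (W₁-even l) (W₁-odd l) l (ℕₚ.≤-refl ∷ []) (ℕₚ.≤-refl ∷ ℕₚ.n≤1+n l ∷ []))
  (λ l → ≼-via (W₁-odd l) (W₁-even (suc l)) (suc l)
                (ℕₚ.n≤1+n l ∷ ℕₚ.≤-refl ∷ []) (ℕₚ.≤-refl ∷ []))

W₂-staircase : Staircase _<_ W₂
W₂-staircase = staircase-interleave W₂-even W₂-odd nonempty (λ l → suc (dbl l) , here refl)
  (λ l → ≼-via (W₂-even l) (W₂-odd l) (suc (dbl l)) (below l) (ℕₚ.≤-refl ∷ []))
  (λ l → ≼-via (W₂-odd l) (W₂-even (suc l)) (suc (dbl l))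
                (ℕₚ.≤-refl ∷ []) (ℕₚ.n≤1+n _ ∷ ℕₚ.m≤n+m _ 2 ∷ ℕₚ.≤-refl ∷ []))
  where
  nonempty : ∀ l → Nonempty (W₂-even l)
  nonempty zero    = 0 , here refl
  nonempty (suc l) = dbl (suc l) , here refl
  below : ∀ l → All (_≤ suc (dbl l)) (indices (W₂-even l))
  below zero    = z≤n ∷ ℕₚ.≤-refl ∷ []
  below (suc l) = ℕₚ.n≤1+n _ ∷ ℕₚ.≤-refl ∷ ℕₚ.m≤n+m _ 2 ∷ []

W₃-staircase : Staircase _<_ W₃
W₃-staircase = staircase-adjacent W₃ (λ j → dbl j , here refl) λ j →
  ≼-via (W₃ j) (W₃ (suc j)) (dbl (suc j))
        (ℕₚ.m≤n+m _ 2 ∷ ℕₚ.n≤1+n _ ∷ ℕₚ.≤-refl ∷ [])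
        (ℕₚ.≤-refl ∷ ℕₚ.n≤1+n _ ∷ ℕₚ.m≤n+m _ 2 ∷ [])

W₁-nonneg : ∀ n → NonnegWeights (W₁ n)
W₁-nonneg = interleave-∀ NonnegWeights (λ l → NonnegCoeffs-var _ ∷ [])
                                       (λ l → NonnegCoeffs-var _ ∷ NonnegCoeffs-var _ ∷ [])

W₂-nonneg : ∀ n → NonnegWeights (W₂ n)
W₂-nonneg = interleave-∀ NonnegWeights even (λ l → NonnegCoeffs-var _ ∷ [])
  where
  even : ∀ l → NonnegWeights (W₂-even l)
  even zero    = NonnegCoeffs-const 1 ∷ NonnegCoeffs-var _ ∷ []
  even (suc l) = NonnegCoeffs-const 1 ∷ NonnegCoeffs-var _ ∷ NonnegCoeffs-var _ ∷ []

W₃-nonneg : ∀ n → NonnegWeights (W₃ n)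
W₃-nonneg n = NonnegCoeffs-var _ ∷ NonnegCoeffs-const 1 ∷ NonnegCoeffs-var _ ∷ []

theorem6p1 : CoeffTP P
theorem6p1 = CoeffTP-resp-≈ B₂◂W₃≈P (◂-coeffTP B₂ W₃ B₂-coeffTP W₃-staircase W₃-nonneg)
  where
  B₁-coeffTP : CoeffTP B₁
  B₁-coeffTP = ◂-coeffTP 1ᴹ W₁ 1ᴹ-coeffTP W₁-staircase W₁-nonneg
  B₂-coeffTP : CoeffTP B₂
  B₂-coeffTP = ◂-coeffTP B₁ W₂ B₁-coeffTP W₂-staircase W₂-nonneg
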